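{- Let $n\ge3$ be odd, $d\ge1$, and let $c=[\frac{n-1}{2},\dots,\frac{n-1}{2}]$ be the center of the cube $n^d$. Let $\ell$ be a line with $c\in\ell$ and $\dim(\ell)=k$, and let $p\in\ell$ with $p\ne c$. Then $\deg(p)=2^{k}-1+\frac{3^{d-k}-1}{2}$.
   Context: Let $[n]=\{0,\dots,n-1\}$; the cube $n^d$ is $[n]^d$. A set of $n$ distinct points is a line if it can be ordered $(q^1,\dots,q^n)$ such that in each coordinate the sequence of values is strictly increasing, strictly decreasing or constant, with at least one coordinate non-constant. The dimension $\dim(\ell)$ of a line is the number of coordinates that are non-constant along it. The degree $\deg(p)$ of a point $p$ is the number of lines containing $p$. -}

module Defs where

open import Data.Nat using (ℕ; _<_)
open import Data.Fin using (Fin; toℕ)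
open import Data.Fin.Subset using (Subset; _∈_; ∣_∣)
open import Data.Vec using (Vec; lookup)
open import Data.Product using (Σ; ∃; _×_)
open import Data.Sum using (_⊎_)
open import Data.List using (List; length)
open import Data.List.Relation.Unary.All using (All)
open import Data.List.Relation.Unary.Any using (Any)
open import Data.List.Relation.Unary.AllPairs using (AllPairs)
open import Relation.Nullary using (¬_)
open import Relation.Binary.PropositionalEquality using (_≡_)
open import Function.Bundles using (_⇔_)
open import Function.Definitions using (Injective)

Point : ℕ → ℕ → Set
Point n d = Vec (Fin n) d

Seq : ℕ → ℕ → Set
Seq n d = Fin n → Point n d

module _ {n : ℕ} where
  StrictInc : (Fin n → Fin n) → Set
  StrictInc f = ∀ i j → toℕ i < toℕ j → toℕ (f i) < toℕ (f j)

  StrictDec : (Fin n → Fin n) → Set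
  StrictDec f = ∀ i j → toℕ i < toℕ j → toℕ (f j) < toℕ (f i)

  Constant : (Fin n → Fin n) → Set
  Constant f = ∀ i j → f i ≡ f j

module _ {n d : ℕ} where
  coord : Seq n d → Fin d → Fin n → Fin n
  coord q m j = lookup (q j) m

  IsLine : Seq n d → Set
  IsLine q = Injective _≡_ _≡_ q
           × (∀ m → StrictInc (coord q m) ⊎ StrictDec (coord q m) ⊎ Constant (coord q m))
           × ∃ (λ m → ¬ Constant (coord q m))

  _∈ₗ_ : Point n d → Seq n d → Set
  x ∈ₗ q = ∃ (λ j → q j ≡ x)

  SameSet : Seq n d → Seq n d → Set
  SameSet q r = ∀ x → (x ∈ₗ q) ⇔ (x ∈ₗ r)

  HasDim : Seq n d → ℕ → Set
  HasDim q k = Σ (Subset d) (λ s → (∣ s ∣ ≡ k) × (∀ m → (m ∈ s) ⇔ (¬ Constant (coord q m))))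

  Degree : Point n d → ℕ → Set
  Degree p N = Σ (List (Seq n d)) (λ Ls →
      All IsLine Ls
    × All (λ q → p ∈ₗ q) Ls
    × AllPairs (λ q r → ¬ SameSet q r) Ls
    × (∀ q → IsLine q → p ∈ₗ q → Any (SameSet q) Ls)
    × length Ls ≡ N)

module Submission where

-- Every line is traced by a non-constant pattern: a vector of coordinate
-- directions inc (j ↦ j), dec (j ↦ n-1-j) or constant, because a strictly
-- monotone self-map of [n] is the identity or its reversal.  Two patterns
-- give the same point set iff they are equal or flips of each other, so
-- deg p is the number of non-constant patterns through p counted up to
-- flipping (degree-from-patterns).  The patterns v with trace v j ≡ p form
-- a cartesian product of per-coordinate choices (patternsThrough), which
-- makes them countable.
--
-- Let p ≠ c lie on a line ℓ through the centre c, at parameter j₀ ≠ mid.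
-- Then p has its d-k constant coordinates equal to mid and the k others in
-- {j₀, n-1-j₀} (Axis).  A line through p reaches p at parameter j₀ or
-- n-1-j₀, giving 2^k - 1 patterns up to flipping, or at the fixed parameter
-- mid, giving (3^(d-k) - 1)/2 flip pairs (Centre).  lemma15 assembles this.

open import Defs
open import Data.Nat using (ℕ; zero; suc; _≤_; _<_; _+_; _*_; _∸_; _^_; _/_; _%_; z≤n; s≤s)
open import Data.Nat.Properties
  using ( *-comm; *-identityˡ; +-identityʳ; +-suc; suc-injective; m∸n+n≡m; m+n∸n≡m; *-cancelʳ-≡
        ; ≤-refl; ≤-trans; ≤-antisym; n≤1+n; ≮⇒≥; <⇒≱; ∸-monoʳ-<)
open import Data.Nat.DivMod using (m≡m%n+[m/n]*n; m*n/n≡m)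
open import Data.Nat.Solver using (module +-*-Solver)
open +-*-Solver using (solve; _:=_; _:+_; _:*_; con)
open import Data.Fin using (Fin; toℕ; fromℕ<; opposite) renaming (zero to fzero; suc to fsuc)
open import Data.Fin.Properties
  using (toℕ-injective; toℕ<n; fromℕ<-toℕ; toℕ-fromℕ<; opposite-prop; opposite-involutive; _≟_)
open import Data.Vec using (Vec; []; _∷_; lookup; map; tabulate; count; here; there)
open import Data.Vec.Properties
  using (lookup-map; map-∘; map-cong; ∷-injective; lookup∘tabulate; tabulate∘lookup; tabulate-cong)
open import Data.List using (List; []; _∷_; [_]; _++_; filter; length; cartesianProductWith)
import Data.List as List
open import Data.List.Membership.Propositional using (_∈_)
open import Data.List.Properties using (length-map; length-++; filter-++; filter-all; filter-none; filter-accept; filter-reject)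
open import Data.List.Membership.Propositional.Properties
  using (∈-filter⁺; ∈-filter⁻; ∈-++⁺ˡ; ∈-++⁺ʳ; ∈-++⁻)
open import Data.List.Relation.Unary.Any using (Any; here; there)
import Data.List.Relation.Unary.Any as Any
import Data.List.Relation.Unary.Any.Properties as Any⁺
open import Data.List.Relation.Unary.All using (All; []; _∷_)
import Data.List.Relation.Unary.All as All
open import Data.List.Relation.Unary.AllPairs using (AllPairs; []; _∷_)
import Data.List.Relation.Unary.AllPairs.Properties as AllPairs
import Data.List.Relation.Unary.All.Properties as All
open import Data.List.Relation.Unary.Unique.Propositional using (Unique)
import Data.List.Relation.Unary.Unique.Propositional.Properties as Unique
open import Data.Fin.Subset using (Subset; ∣_∣; ∁) renaming (_∈_ to _∈ₛ_)
open import Data.Fin.Subset.Properties using (drop-there; ∣∁p∣≡n∸∣p∣)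
open import Data.Bool using (Bool; true; false; not)
open import Data.Maybe using (Maybe; just; nothing)
import Data.Maybe as Maybe
open import Data.Maybe.Properties using (≡-dec)
import Data.Bool.Properties as Bool
open import Data.Product using (_×_; _,_; proj₁; proj₂; Σ; ∃)
open import Data.Sum using (_⊎_; inj₁; inj₂)
open import Data.Empty using (⊥; ⊥-elim)
open import Relation.Nullary using (¬_; ¬?; does; yes; no)
open import Relation.Unary using (Decidable)
open import Relation.Binary.PropositionalEquality hiding ([_])
open import Function using (_∘_)
open import Function.Bundles using (_⇔_; mk⇔; Equivalence)
open import Function.Properties.Equivalence using () renaming (trans to ⇔-trans; sym to ⇔-sym)

-- A strictly increasing map Fin n → Fin n is
-- the identity and a strictly decreasing one is 'opposite'; this is what
-- makes every line a "pattern" line (each coordinate is j, n-1-j or constant).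
module _ {n : ℕ} where

  opposite-reverses : ∀ {a b : Fin n} → toℕ a < toℕ b → toℕ (opposite b) < toℕ (opposite a)
  opposite-reverses {a} {b} a<b rewrite opposite-prop a | opposite-prop b = ∸-monoʳ-< (s≤s a<b) (toℕ<n b)

  opposite-injective : ∀ {a b : Fin n} → opposite a ≡ opposite b → a ≡ b
  opposite-injective {a} {b} e =
    trans (sym (opposite-involutive a)) (trans (cong opposite e) (opposite-involutive b))

  strictInc-≥ : ∀ (f : Fin n → Fin n) → StrictInc f → ∀ i → toℕ i ≤ toℕ (f i)
  strictInc-≥ f f-inc i =
    subst (λ x → toℕ i ≤ toℕ (f x)) (fromℕ<-toℕ i (toℕ<n i)) (below (toℕ i) (toℕ<n i))
    where
      below : ∀ t (t<n : t < n) → t ≤ toℕ (f (fromℕ< t<n))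
      below zero    _   = z≤n
      below (suc t) t<n = ≤-trans (s≤s (below t t<n′)) (f-inc (fromℕ< t<n′) (fromℕ< t<n) step)
        where
          t<n′ : t < n
          t<n′ = ≤-trans (n≤1+n (suc t)) t<n
          step : toℕ (fromℕ< t<n′) < toℕ (fromℕ< t<n)
          step rewrite toℕ-fromℕ< t<n′ | toℕ-fromℕ< t<n = ≤-refl

  -- Conjugating by 'opposite' turns the lower bound into an upper bound.
  strictInc-id : ∀ (f : Fin n → Fin n) → StrictInc f → ∀ i → f i ≡ i
  strictInc-id f f-inc i =
    toℕ-injective (≤-antisym (≮⇒≥ (λ i<fi → <⇒≱ (opposite-reverses i<fi) conj-≥)) (strictInc-≥ f f-inc i))
    where
      conj-≥ : toℕ (opposite i) ≤ toℕ (opposite (f i))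
      conj-≥ = subst (λ x → toℕ (opposite i) ≤ toℕ (opposite (f x))) (opposite-involutive i)
                 (strictInc-≥ (λ x → opposite (f (opposite x)))
                   (λ a b a<b → opposite-reverses (f-inc _ _ (opposite-reverses a<b))) (opposite i))

  strictDec-opposite : ∀ (f : Fin n → Fin n) → StrictDec f → ∀ i → f i ≡ opposite i
  strictDec-opposite f f-dec i =
    trans (sym (opposite-involutive (f i)))
          (cong opposite (strictInc-id (opposite ∘ f) (λ a b a<b → opposite-reverses (f-dec a b a<b)) i))

data Dir (n : ℕ) : Set where
  inc dec : Dir n
  cst : Fin n → Dir n

Pattern : ℕ → ℕ → Set
Pattern n d = Vec (Dir n) d

module _ {n : ℕ} where

  data Moving : Dir n → Set where
    inc : Moving inc
    dec : Moving dec

  ev : Dir n → Fin n → Fin n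
  ev inc     j = j
  ev dec     j = opposite j
  ev (cst a) j = a

  flipDir : Dir n → Dir n
  flipDir inc     = dec
  flipDir dec     = inc
  flipDir (cst a) = cst a

  ev-flip : ∀ o j → ev (flipDir o) j ≡ ev o (opposite j)
  ev-flip inc     j = refl
  ev-flip dec     j = sym (opposite-involutive j)
  ev-flip (cst a) j = refl

  ev-injective : ∀ {o i j} → Moving o → ev o i ≡ ev o j → i ≡ j
  ev-injective inc e = e
  ev-injective dec e = opposite-injective e

  ev-solve : ∀ {o j x} → Moving o → ev o j ≡ x → j ≡ x ⊎ j ≡ opposite x
  ev-solve inc e = inj₁ e
  ev-solve {j = j} dec e = inj₂ (trans (sym (opposite-involutive j)) (cong opposite e))

  moving-align : ∀ {a b} → Moving a → Moving b →
                 (∀ i → ev b i ≡ ev a i) ⊎ (∀ i → ev b i ≡ ev a (opposite i))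
  moving-align inc inc = inj₁ (λ i → refl)
  moving-align inc dec = inj₂ (λ i → refl)
  moving-align dec inc = inj₂ (λ i → sym (opposite-involutive i))
  moving-align dec dec = inj₁ (λ i → refl)

  trace : ∀ {d} → Pattern n d → Seq n d
  trace v j = map (λ o → ev o j) v

  flip : ∀ {d} → Pattern n d → Pattern n d
  flip = map flipDir

  lookup-trace : ∀ {d} (v : Pattern n d) m j → lookup (trace v j) m ≡ ev (lookup v m) j
  lookup-trace v m j = lookup-map m (λ o → ev o j) v

  trace-flip : ∀ {d} (v : Pattern n d) j → trace (flip v) j ≡ trace v (opposite j)
  trace-flip v j = trans (sym (map-∘ (λ o → ev o j) flipDir v)) (map-cong (λ o → ev-flip o j) v)

  leading : ∀ {d} → Pattern n d → Maybe Bool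
  leading []          = nothing
  leading (inc   ∷ v) = just true
  leading (dec   ∷ v) = just false
  leading (cst _ ∷ v) = leading v

  leading-flip : ∀ {d} (v : Pattern n d) → leading (flip v) ≡ Maybe.map not (leading v)
  leading-flip []          = refl
  leading-flip (inc   ∷ v) = refl
  leading-flip (dec   ∷ v) = refl
  leading-flip (cst _ ∷ v) = leading-flip v

  NonConstant : ∀ {d} → Pattern n d → Set
  NonConstant v = ¬ leading v ≡ nothing

  -- Of a non-constant pattern and its flip, exactly one is canonical.
  Canonical : ∀ {d} → Pattern n d → Set
  Canonical v = leading v ≡ just true

  nonConstant? : ∀ {d} → Decidable (NonConstant {d})
  nonConstant? v = ¬? (≡-dec Bool._≟_ (leading v) nothing)

  canonical? : ∀ {d} → Decidable (Canonical {d})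
  canonical? v = ≡-dec Bool._≟_ (leading v) (just true)

  flip-nonConstant : ∀ {d} (v : Pattern n d) → NonConstant v → NonConstant (flip v)
  flip-nonConstant v nc e = nc (map-nothing⁻ (trans (sym (leading-flip v)) e))
    where
      map-nothing⁻ : ∀ {m : Maybe Bool} → Maybe.map not m ≡ nothing → m ≡ nothing
      map-nothing⁻ {nothing} _ = refl

  canonical-or-flip : ∀ {d} (v : Pattern n d) → NonConstant v → Canonical v ⊎ Canonical (flip v)
  canonical-or-flip v nc with leading v in e
  ... | just true  = inj₁ refl
  ... | just false = inj₂ (trans (leading-flip v) (cong (Maybe.map not) e))
  ... | nothing    = ⊥-elim (nc refl)

  canonical-flip : ∀ {d} (v : Pattern n d) → Canonical v → ¬ Canonical (flip v)
  canonical-flip v c c′ with trans (sym (trans (leading-flip v) (cong (Maybe.map not) c))) c′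
  ... | ()

  canonical⇒nonConstant : ∀ {d} (v : Pattern n d) → Canonical v → NonConstant v
  canonical⇒nonConstant v c e with trans (sym c) e
  ... | ()

  moving-coordinate : ∀ {d} (v : Pattern n d) → NonConstant v → ∃ λ m → Moving (lookup v m)
  moving-coordinate []          nc = ⊥-elim (nc refl)
  moving-coordinate (inc   ∷ v) _  = fzero , inc
  moving-coordinate (dec   ∷ v) _  = fzero , dec
  moving-coordinate (cst _ ∷ v) nc = let m , mv = moving-coordinate v nc in fsuc m , mv

  moving⇒nonConstant : ∀ {d} (v : Pattern n d) m → Moving (lookup v m) → NonConstant v
  moving⇒nonConstant (inc   ∷ v) _        _  = λ ()
  moving⇒nonConstant (dec   ∷ v) _        _  = λ ()
  moving⇒nonConstant (cst _ ∷ v) (fsuc m) mv = moving⇒nonConstant v m mv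

  trace-injective : ∀ {d} (v : Pattern n d) → NonConstant v → ∀ {i j} → trace v i ≡ trace v j → i ≡ j
  trace-injective v nc {i} {j} e =
    let m , mv = moving-coordinate v nc
    in ev-injective mv (trans (sym (lookup-trace v m i)) (trans (cong (λ x → lookup x m) e) (lookup-trace v m j)))

LineCoordinate : ∀ {n} → (Fin n → Fin n) → Set
LineCoordinate f = StrictInc f ⊎ StrictDec f ⊎ Constant f

lineCoordinate-resp : ∀ {n} {f g : Fin n → Fin n} → (∀ j → f j ≡ g j) → LineCoordinate g → LineCoordinate f
lineCoordinate-resp f≗g (inj₁ up) =
  inj₁ (λ i j i<j → subst₂ (λ a b → toℕ a < toℕ b) (sym (f≗g i)) (sym (f≗g j)) (up i j i<j))
lineCoordinate-resp f≗g (inj₂ (inj₁ down)) =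
  inj₂ (inj₁ (λ i j i<j → subst₂ (λ a b → toℕ a < toℕ b) (sym (f≗g j)) (sym (f≗g i)) (down i j i<j)))
lineCoordinate-resp f≗g (inj₂ (inj₂ const)) =
  inj₂ (inj₂ (λ i j → trans (f≗g i) (trans (const i j) (sym (f≗g j)))))

vec-ext : ∀ {A : Set} {d} (xs ys : Vec A d) → (∀ m → lookup xs m ≡ lookup ys m) → xs ≡ ys
vec-ext xs ys e = trans (sym (tabulate∘lookup xs)) (trans (tabulate-cong e) (tabulate∘lookup ys))

-- Lines are exactly the traces of non-constant patterns.  Telling moving and
-- constant coordinates apart needs two parameters z and its opposite z̄ that
-- differ, i.e. a cube of side at least 2.
module Lines {n : ℕ} (z : Fin n) (z≢z̄ : ¬ z ≡ opposite z) where

  ev-lineCoordinate : ∀ (o : Dir n) → LineCoordinate (ev o)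
  ev-lineCoordinate inc     = inj₁ (λ i j i<j → i<j)
  ev-lineCoordinate dec     = inj₂ (inj₁ (λ i j i<j → opposite-reverses i<j))
  ev-lineCoordinate (cst a) = inj₂ (inj₂ (λ i j → refl))

  moving-nonConstantMap : ∀ {o} → Moving o → ¬ Constant (ev o)
  moving-nonConstantMap inc const = z≢z̄ (const z (opposite z))
  moving-nonConstantMap dec const = z≢z̄ (opposite-injective (const z (opposite z)))

  coordinate-moves⇔ : ∀ {d} {q : Seq n d} (v : Pattern n d) → (∀ j → q j ≡ trace v j) →
                      ∀ m → Moving (lookup v m) ⇔ (¬ Constant (coord q m))
  coordinate-moves⇔ {q = q} v q≗v m = mk⇔ to from
    where
      coord≗ : ∀ j → coord q m j ≡ ev (lookup v m) j
      coord≗ j = trans (cong (λ x → lookup x m) (q≗v j)) (lookup-trace v m j)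
      to : Moving (lookup v m) → ¬ Constant (coord q m)
      to mv const = moving-nonConstantMap mv (λ i j → trans (sym (coord≗ i)) (trans (const i j) (coord≗ j)))
      from : ¬ Constant (coord q m) → Moving (lookup v m)
      from nc with lookup v m | coord≗
      ... | inc   | _ = inc
      ... | dec   | _ = dec
      ... | cst a | e = ⊥-elim (nc (λ i j → trans (e i) (sym (e j))))

  trace-isLine : ∀ {d} (v : Pattern n d) → NonConstant v → IsLine (trace v)
  trace-isLine v nc =
      trace-injective v nc
    , (λ m → lineCoordinate-resp (lookup-trace v m) (ev-lineCoordinate (lookup v m)))
    , (let m , mv = moving-coordinate v nc in m , Equivalence.to (coordinate-moves⇔ v (λ _ → refl) m) mv)

  line-pattern : ∀ {d} (q : Seq n d) → IsLine q →
                 Σ (Pattern n d) λ v → NonConstant v × (∀ j → q j ≡ trace v j)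
  line-pattern {d} q (_ , shape , m₀ , m₀-moves) = v , nonConstant , q≗trace
    where
      dirOf : ∀ {f : Fin n → Fin n} → LineCoordinate f → Dir n
      dirOf (inj₁ _)               = inc
      dirOf (inj₂ (inj₁ _))        = dec
      dirOf {f} (inj₂ (inj₂ _))    = cst (f z)

      dirOf-ev : ∀ {f} (t : LineCoordinate f) j → f j ≡ ev (dirOf t) j
      dirOf-ev {f} (inj₁ up)           j = strictInc-id f up j
      dirOf-ev {f} (inj₂ (inj₁ down))  j = strictDec-opposite f down j
      dirOf-ev     (inj₂ (inj₂ const)) j = const j z

      v : Pattern n d
      v = tabulate (λ m → dirOf (shape m))

      lookup-v : ∀ m → lookup v m ≡ dirOf (shape m)
      lookup-v = lookup∘tabulate (λ m → dirOf (shape m))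

      q≗trace : ∀ j → q j ≡ trace v j
      q≗trace j = vec-ext (q j) (trace v j) λ m →
        trans (dirOf-ev (shape m) j) (sym (trans (lookup-trace v m j) (cong (λ o → ev o j) (lookup-v m))))

      nonConstant : NonConstant v
      nonConstant = moving⇒nonConstant v m₀ (Equivalence.from (coordinate-moves⇔ v q≗trace m₀) m₀-moves)

  z̄ : Fin n
  z̄ = opposite z

  dir-separated : ∀ a b → ev a z ≡ ev b z → ev a z̄ ≡ ev b z̄ → a ≡ b
  dir-separated inc     inc     _ _ = refl
  dir-separated dec     dec     _ _ = refl
  dir-separated (cst x) (cst y) e _ = cong cst e
  dir-separated inc     dec     e _ = ⊥-elim (z≢z̄ e)
  dir-separated dec     inc     e _ = ⊥-elim (z≢z̄ (sym e))
  dir-separated inc     (cst y) e e′ = ⊥-elim (z≢z̄ (trans e (sym e′)))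
  dir-separated (cst x) inc     e e′ = ⊥-elim (z≢z̄ (trans (sym e) e′))
  dir-separated dec     (cst y) e e′ = ⊥-elim (z≢z̄ (opposite-injective (trans e (sym e′))))
  dir-separated (cst x) dec     e e′ = ⊥-elim (z≢z̄ (opposite-injective (trans (sym e) e′)))

  pattern-separated : ∀ {d} (v w : Pattern n d) → trace v z ≡ trace w z → trace v z̄ ≡ trace w z̄ → v ≡ w
  pattern-separated v w e e′ = vec-ext v w λ m →
    dir-separated (lookup v m) (lookup w m) (at m z e) (at m z̄ e′)
    where
      at : ∀ m i → trace v i ≡ trace w i → ev (lookup v m) i ≡ ev (lookup w m) i
      at m i e = trans (sym (lookup-trace v m i)) (trans (cong (λ x → lookup x m) e) (lookup-trace w m i))

  reparametrisation : ∀ {d} (v w : Pattern n d) → NonConstant v → NonConstant w → ∀ {j j′} →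
                      trace v j ≡ trace w z → trace v j′ ≡ trace w z̄ →
                      (j ≡ z × j′ ≡ z̄) ⊎ (j ≡ z̄ × j′ ≡ z)
  reparametrisation v w ncv ncw {j} {j′} E E′ = align (lookup w m) (at E) (at E′)
    where
      m = proj₁ (moving-coordinate v ncv)
      mv = proj₂ (moving-coordinate v ncv)
      a = lookup v m

      at : ∀ {i k} → trace v i ≡ trace w k → ev a i ≡ ev (lookup w m) k
      at {i} {k} e = trans (sym (lookup-trace v m i)) (trans (cong (λ x → lookup x m) e) (lookup-trace w m k))

      aligned : ∀ {b} → Moving b → ev a j ≡ ev b z → ev a j′ ≡ ev b z̄ →
                (j ≡ z × j′ ≡ z̄) ⊎ (j ≡ z̄ × j′ ≡ z)
      aligned mb e e′ with moving-align mv mb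
      ... | inj₁ same = inj₁ (ev-injective mv (trans e (same z)) , ev-injective mv (trans e′ (same z̄)))
      ... | inj₂ rev  = inj₂ ( ev-injective mv (trans e (rev z))
                             , trans (ev-injective mv (trans e′ (rev z̄))) (opposite-involutive z))

      -- w cannot be constant where v moves: both endpoints of w would then coincide.
      align : ∀ b → ev a j ≡ ev b z → ev a j′ ≡ ev b z̄ →
              (j ≡ z × j′ ≡ z̄) ⊎ (j ≡ z̄ × j′ ≡ z)
      align inc     = aligned inc
      align dec     = aligned dec
      align (cst y) e e′ = ⊥-elim (z≢z̄ (trace-injective w ncw
        (trans (sym E) (trans (cong (trace v) (ev-injective mv (trans e (sym e′)))) E′))))

  same-line : ∀ {d} (v w : Pattern n d) → NonConstant v → NonConstant w →
              (∀ i → trace w i ∈ₗ trace v) → w ≡ v ⊎ w ≡ flip v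
  same-line v w ncv ncw w⊆v with w⊆v z | w⊆v z̄
  ... | j , E | j′ , E′ with reparametrisation v w ncv ncw E E′
  ... | inj₁ (refl , refl) = inj₁ (sym (pattern-separated v w E E′))
  ... | inj₂ (refl , refl) = inj₂ (sym (pattern-separated (flip v) w
          (trans (trace-flip v z) E)
          (trans (trace-flip v z̄) (trans (cong (trace v) (opposite-involutive z)) E′))))

  sameSet-pointwise : ∀ {d} {q r : Seq n d} → (∀ j → q j ≡ r j) → SameSet q r
  sameSet-pointwise q≗r x = mk⇔ (λ (j , e) → j , trans (sym (q≗r j)) e) (λ (j , e) → j , trans (q≗r j) e)

  sameSet-flip : ∀ {d} {q : Seq n d} (v : Pattern n d) → (∀ j → q j ≡ trace v j) → SameSet q (trace (flip v))
  sameSet-flip v q≗v x = mk⇔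
    (λ (j , e) → opposite j , trans (trace-flip v (opposite j))
                               (trans (cong (trace v) (opposite-involutive j)) (trans (sym (q≗v j)) e)))
    (λ (j , e) → opposite j , trans (q≗v (opposite j)) (trans (sym (trace-flip v j)) e))

  degree-from-patterns : ∀ {d} (p : Point n d) (Ps : List (Pattern n d)) →
    All NonConstant Ps → All (λ v → p ∈ₗ trace v) Ps → Unique Ps →
    (∀ {v} → v ∈ Ps → ¬ flip v ∈ Ps) →
    (∀ v → NonConstant v → p ∈ₗ trace v → v ∈ Ps ⊎ flip v ∈ Ps) →
    Degree p (length Ps)
  degree-from-patterns {d} p Ps nonConstant through unique flip-free complete =
      List.map trace Ps
    , All.map⁺ (All.map (λ {v} → trace-isLine v) nonConstant)
    , All.map⁺ through
    , AllPairs.map⁺ (allPairs-within unique distinct)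
    , covers
    , length-map trace Ps
    where
      allPairs-within : ∀ {R S : Pattern n d → Pattern n d → Set} {xs} → AllPairs R xs →
                        (∀ {v w} → v ∈ xs → w ∈ xs → R v w → S v w) → AllPairs S xs
      allPairs-within []         f = []
      allPairs-within (rs ∷ rss) f =
          All.tabulate (λ w∈ → f (here refl) (there w∈) (All.lookup rs w∈))
        ∷ allPairs-within rss (λ v∈ w∈ → f (there v∈) (there w∈))

      distinct : ∀ {v w} → v ∈ Ps → w ∈ Ps → ¬ v ≡ w → ¬ SameSet (trace v) (trace w)
      distinct {v} {w} v∈ w∈ v≢w same
        with same-line v w (All.lookup nonConstant v∈) (All.lookup nonConstant w∈)
                           (λ i → Equivalence.from (same (trace w i)) (i , refl))
      ... | inj₁ w≡v  = v≢w (sym w≡v)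
      ... | inj₂ w≡v̄ = flip-free v∈ (subst (_∈ Ps) w≡v̄ w∈)

      listed : ∀ {q v} → v ∈ Ps → SameSet q (trace v) → Any (SameSet q) (List.map trace Ps)
      listed v∈ same = Any⁺.map⁺ (Any.map (λ { refl → same }) v∈)

      covers : ∀ q → IsLine q → p ∈ₗ q → Any (SameSet q) (List.map trace Ps)
      covers q q-line (j , qj≡p) with line-pattern q q-line
      ... | v , nc , q≗v with complete v nc (j , trans (sym (q≗v j)) qj≡p)
      ...   | inj₁ v∈  = listed v∈ (sameSet-pointwise q≗v)
      ...   | inj₂ v̄∈ = listed v̄∈ (sameSet-flip v q≗v)

-- The patterns v with
-- trace v j ≡ p are exactly the vectors of coordinatewise solutions, so they
-- form a cartesian product of short lists of directions.
module _ {n : ℕ} where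

  movingDirs : List (Dir n)
  movingDirs = inc ∷ dec ∷ []

  dirsThrough : Fin n → Fin n → List (Dir n)
  dirsThrough j x = cst x ∷ filter (λ o → ev o j ≟ x) movingDirs

  ∈-dirsThrough : ∀ j x o → o ∈ dirsThrough j x ⇔ ev o j ≡ x
  ∈-dirsThrough j x o = mk⇔ to (from o)
    where
      to : o ∈ dirsThrough j x → ev o j ≡ x
      to (here refl) = refl
      to (there o∈)  = proj₂ (∈-filter⁻ (λ o → ev o j ≟ x) {xs = movingDirs} o∈)
      from : ∀ o → ev o j ≡ x → o ∈ dirsThrough j x
      from (cst a) e = here (cong cst e)
      from inc     e = there (∈-filter⁺ (λ o → ev o j ≟ x) {xs = movingDirs} (here refl) e)
      from dec     e = there (∈-filter⁺ (λ o → ev o j ≟ x) {xs = movingDirs} (there (here refl)) e)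

  dirsThrough-unique : ∀ j x → Unique (dirsThrough j x)
  dirsThrough-unique j x =
      All.filter⁺ (λ o → ev o j ≟ x) {xs = movingDirs} ((λ ()) ∷ (λ ()) ∷ [])
    ∷ Unique.filter⁺ (λ o → ev o j ≟ x) {xs = movingDirs} (((λ ()) ∷ []) ∷ [] ∷ [])

  patternsThrough : ∀ {d} → Fin n → Point n d → List (Pattern n d)
  patternsThrough j []      = [ [] ]
  patternsThrough j (x ∷ p) = cartesianProductWith _∷_ (dirsThrough j x) (patternsThrough j p)

  ∈-patternsThrough : ∀ {d} j (p : Point n d) v → v ∈ patternsThrough j p ⇔ trace v j ≡ p
  ∈-patternsThrough j []      []      = mk⇔ (λ _ → refl) (λ _ → here refl)
  ∈-patternsThrough j (x ∷ p) (o ∷ v) = mk⇔ to from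
    where
      to : o ∷ v ∈ patternsThrough j (x ∷ p) → trace (o ∷ v) j ≡ x ∷ p
      to mem = let o∈ , v∈ = Any⁺.cartesianProductWith⁻ _∷_ ∷-injective _ _ mem
               in cong₂ _∷_ (Equivalence.to (∈-dirsThrough j x o) o∈) (Equivalence.to (∈-patternsThrough j p v) v∈)
      from : trace (o ∷ v) j ≡ x ∷ p → o ∷ v ∈ patternsThrough j (x ∷ p)
      from e = let e₀ , e₁ = ∷-injective e
               in Any⁺.cartesianProductWith⁺ _∷_ (cong₂ _∷_)
                    (Equivalence.from (∈-dirsThrough j x o) e₀) (Equivalence.from (∈-patternsThrough j p v) e₁)

  patternsThrough-unique : ∀ {d} j (p : Point n d) → Unique (patternsThrough j p)
  patternsThrough-unique j []      = [] ∷ []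
  patternsThrough-unique j (x ∷ p) =
    Unique.cartesianProductWith⁺ _∷_ ∷-injective (dirsThrough-unique j x) (patternsThrough-unique j p)

length-cartesianProductWith : ∀ {A B C : Set} (f : A → B → C) xs ys →
                              length (cartesianProductWith f xs ys) ≡ length xs * length ys
length-cartesianProductWith f []       ys = refl
length-cartesianProductWith f (x ∷ xs) ys =
  trans (length-++ (List.map (f x) ys)) (cong₂ _+_ (length-map (f x) ys) (length-cartesianProductWith f xs ys))

filter-map : ∀ {A B : Set} {P : B → Set} (P? : Decidable P) (f : A → B) xs →
             filter P? (List.map f xs) ≡ List.map f (filter (P? ∘ f) xs)
filter-map P? f []       = refl
filter-map P? f (x ∷ xs) with does (P? (f x))
... | true  = cong (f x ∷_) (filter-map P? f xs)
... | false = filter-map P? f xs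

length-filter-++ : ∀ {A : Set} {P : A → Set} (P? : Decidable P) xs ys →
                   length (filter P? (xs ++ ys)) ≡ length (filter P? xs) + length (filter P? ys)
length-filter-++ P? xs ys = trans (cong length (filter-++ P? xs ys)) (length-++ (filter P? xs))

module _ {n : ℕ} where

  length-filter-cartesian : ∀ {d} {P : Pattern n (suc d) → Set} (P? : Decidable P) a as (S : List (Pattern n d)) →
    length (filter P? (cartesianProductWith _∷_ (a ∷ as) S))
      ≡ length (filter (P? ∘ (a ∷_)) S) + length (filter P? (cartesianProductWith _∷_ as S))
  length-filter-cartesian P? a as S =
    trans (length-filter-++ P? (List.map (a ∷_) S) _)
          (cong (_+ _) (trans (cong length (filter-map P? (a ∷_) S)) (length-map (a ∷_) (filter (P? ∘ (a ∷_)) S))))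

  all-nonConstant : ∀ {d} (as : List (Dir n)) (S : List (Pattern n d)) →
                    All Moving as → All NonConstant (cartesianProductWith _∷_ as S)
  all-nonConstant []       S []          = []
  all-nonConstant (a ∷ as) S (ma ∷ mas) =
    All.++⁺ (All.map⁺ (All.universal (λ w → moving⇒nonConstant (a ∷ w) fzero ma) S)) (all-nonConstant as S mas)

  -- Exactly one pattern through a given point at a given parameter is
  -- constant, namely the point itself repeated.
  nonConstant-count : ∀ {d} j (p : Point n d) →
                      1 + length (filter nonConstant? (patternsThrough j p)) ≡ length (patternsThrough j p)
  nonConstant-count j []      = refl
  nonConstant-count j (x ∷ p) = begin
      1 + length (filter nonConstant? (cartesianProductWith _∷_ (cst x ∷ t) S))
    ≡⟨ cong suc (length-filter-cartesian nonConstant? (cst x) t S) ⟩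
      1 + (length (filter nonConstant? S) + length (filter nonConstant? R))
    ≡⟨ cong (λ l → 1 + length (filter nonConstant? S) + length l)
            (filter-all nonConstant? (all-nonConstant t S moving-t)) ⟩
      1 + length (filter nonConstant? S) + length R
    ≡⟨ cong (_+ length R) (nonConstant-count j p) ⟩
      length S + length R
    ≡⟨ cong (_+ length R) (sym (length-map (cst x ∷_) S)) ⟩
      length (List.map (cst x ∷_) S) + length R
    ≡⟨ sym (length-++ (List.map (cst x ∷_) S)) ⟩
      length (List.map (cst x ∷_) S ++ R)
    ∎
    where
      open ≡-Reasoning
      S = patternsThrough j p
      t = filter (λ o → ev o j ≟ x) movingDirs
      R = cartesianProductWith _∷_ t S
      moving-t : All Moving t
      moving-t = All.filter⁺ (λ o → ev o j ≟ x) {xs = movingDirs} (inc ∷ dec ∷ [])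

  -- Extending by inc keeps a pattern canonical and extending by dec never
  -- does, so the canonical extensions along a coordinate admitting all three
  -- directions are the canonical constant ones plus all increasing ones.
  canonical-split : ∀ {d} a (S : List (Pattern n d)) →
    length (filter canonical? (cartesianProductWith _∷_ (cst a ∷ inc ∷ dec ∷ []) S))
      ≡ length (filter canonical? S) + length S
  canonical-split a S = begin
      length (filter canonical? (cartesianProductWith _∷_ (cst a ∷ inc ∷ dec ∷ []) S))
    ≡⟨ length-filter-cartesian canonical? (cst a) (inc ∷ dec ∷ []) S ⟩
      length (filter canonical? S) + length (filter canonical? (cartesianProductWith _∷_ (inc ∷ dec ∷ []) S))
    ≡⟨ cong (length (filter canonical? S) +_) (length-filter-cartesian canonical? inc (dec ∷ []) S) ⟩
      length (filter canonical? S) + (length (filter (canonical? ∘ (inc ∷_)) S)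
                                      + length (filter canonical? (cartesianProductWith _∷_ (dec ∷ []) S)))
    ≡⟨ cong₂ (λ l k → length (filter canonical? S) + (length l + k))
             (filter-all (canonical? ∘ (inc ∷_)) (All.universal (λ _ → refl) S))
             (trans (length-filter-cartesian canonical? dec [] S)
                    (cong (λ l → length l + 0) (filter-none (canonical? ∘ (dec ∷_)) (All.universal (λ _ ()) S)))) ⟩
      length (filter canonical? S) + (length S + 0)
    ≡⟨ cong (length (filter canonical? S) +_) (+-identityʳ _) ⟩
      length (filter canonical? S) + length S
    ∎
    where open ≡-Reasoning

tripling : ∀ c N → 1 + 2 * c ≡ N → 1 + 2 * (c + N) ≡ 3 * N
tripling c _ refl = solve 1 (λ c → con 1 :+ con 2 :* (c :+ (con 1 :+ con 2 :* c)) := con 3 :* (con 1 :+ con 2 :* c)) refl c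

tail-⇔ : ∀ {d} {b} {s : Subset d} {m} {Q : Set} → (fsuc m ∈ₛ (b ∷ s)) ⇔ Q → (m ∈ₛ s) ⇔ Q
tail-⇔ e = mk⇔ (λ m∈ → Equivalence.to e (there m∈)) (λ q → drop-there (Equivalence.from e q))

-- Counting patterns through a point at the centre parameter mid, a fixed
-- point of 'opposite'.  There the constant direction can be replaced by inc
-- or dec exactly in the coordinates where the point is centred.
module Centre {n : ℕ} (mid : Fin n) (mid-fixed : opposite mid ≡ mid) where

  centred : ∀ {d} → Point n d → ℕ
  centred = count (_≟ mid)

  dirsThrough-centre : dirsThrough mid mid ≡ cst mid ∷ movingDirs
  dirsThrough-centre = cong (cst mid ∷_) (filter-all (λ o → ev o mid ≟ mid) {xs = movingDirs} (refl ∷ mid-fixed ∷ []))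

  dirsThrough-offCentre : ∀ {x} → ¬ x ≡ mid → dirsThrough mid x ≡ [ cst x ]
  dirsThrough-offCentre {x} x≢mid = cong (cst x ∷_) (filter-none (λ o → ev o mid ≟ x) {xs = movingDirs}
    ((λ e → x≢mid (sym e)) ∷ (λ e → x≢mid (trans (sym e) mid-fixed)) ∷ []))

  length-patternsThrough-centre : ∀ {d} (p : Point n d) → length (patternsThrough mid p) ≡ 3 ^ centred p
  length-patternsThrough-centre []      = refl
  length-patternsThrough-centre (x ∷ p) with x ≟ mid
  ... | yes x≡mid = trans (length-cartesianProductWith _∷_ (dirsThrough mid x) (patternsThrough mid p))
    (cong₂ _*_ (cong length (trans (cong (dirsThrough mid) x≡mid) dirsThrough-centre)) (length-patternsThrough-centre p))
  ... | no x≢mid = trans (length-cartesianProductWith _∷_ (dirsThrough mid x) (patternsThrough mid p))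
    (trans (cong₂ _*_ (cong length (dirsThrough-offCentre x≢mid)) (length-patternsThrough-centre p)) (*-identityˡ _))

  -- Of the patterns through a point at parameter mid, all but the constant
  -- one come in flip pairs, and exactly one of each pair is canonical.
  canonical-count : ∀ {d} (p : Point n d) →
                    1 + 2 * length (filter canonical? (patternsThrough mid p)) ≡ length (patternsThrough mid p)
  canonical-count []      = refl
  canonical-count (x ∷ p) with x ≟ mid
  ... | no x≢mid = begin
      1 + 2 * length (filter canonical? (cartesianProductWith _∷_ (dirsThrough mid x) S))
    ≡⟨ cong (λ ds → 1 + 2 * length (filter canonical? (cartesianProductWith _∷_ ds S)))
            (dirsThrough-offCentre x≢mid) ⟩
      1 + 2 * length (filter canonical? (cartesianProductWith _∷_ [ cst x ] S))
    ≡⟨ cong (λ l → 1 + 2 * l) (trans (length-filter-cartesian canonical? (cst x) [] S) (+-identityʳ _)) ⟩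
      1 + 2 * length (filter canonical? S)
    ≡⟨ canonical-count p ⟩
      length S
    ≡⟨ sym (trans (length-cartesianProductWith _∷_ (dirsThrough mid x) S)
                  (trans (cong (λ ds → length ds * length S) (dirsThrough-offCentre x≢mid)) (*-identityˡ _))) ⟩
      length (cartesianProductWith _∷_ (dirsThrough mid x) S)
    ∎
    where
      open ≡-Reasoning
      S = patternsThrough mid p
  ... | yes x≡mid = begin
      1 + 2 * length (filter canonical? (cartesianProductWith _∷_ (dirsThrough mid x) S))
    ≡⟨ cong (λ ds → 1 + 2 * length (filter canonical? (cartesianProductWith _∷_ ds S))) centre ⟩
      1 + 2 * length (filter canonical? (cartesianProductWith _∷_ (cst mid ∷ inc ∷ dec ∷ []) S))
    ≡⟨ cong (λ l → 1 + 2 * l) (canonical-split mid S) ⟩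
      1 + 2 * (length (filter canonical? S) + length S)
    ≡⟨ tripling (length (filter canonical? S)) (length S) (canonical-count p) ⟩
      3 * length S
    ≡⟨ sym (trans (length-cartesianProductWith _∷_ (dirsThrough mid x) S)
                  (cong (λ ds → length ds * length S) centre)) ⟩
      length (cartesianProductWith _∷_ (dirsThrough mid x) S)
    ∎
    where
      open ≡-Reasoning
      S = patternsThrough mid p

      centre : dirsThrough mid x ≡ cst mid ∷ movingDirs
      centre = trans (cong (dirsThrough mid) x≡mid) dirsThrough-centre

  centre-pattern : ∀ {d} (u : Pattern n d) → NonConstant u → ∀ {jc} → (∀ m → lookup (trace u jc) m ≡ mid) →
                   jc ≡ mid × (∀ m → ev (lookup u m) mid ≡ mid)
  centre-pattern u nc {jc} centre =
    jc≡mid , λ m → subst (λ j → ev (lookup u m) j ≡ mid) jc≡mid (trans (sym (lookup-trace u m jc)) (centre m))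
    where
      jc≡mid : jc ≡ mid
      jc≡mid with moving-coordinate u nc
      ... | m , mv with ev-solve mv (trans (sym (lookup-trace u m jc)) (centre m))
      ...   | inj₁ e = e
      ...   | inj₂ e = trans e mid-fixed

  offCentre : ∀ {d} → Point n d → ℕ
  offCentre = count (λ x → ¬? (x ≟ mid))

  subset-sizes : ∀ {d} (s : Subset d) (p : Point n d) → (∀ m → m ∈ₛ s ⇔ (¬ lookup p m ≡ mid)) →
                 ∣ s ∣ ≡ offCentre p × ∣ ∁ s ∣ ≡ centred p
  subset-sizes []         []      _ = refl , refl
  subset-sizes (true ∷ s) (x ∷ p) s⇔ with x ≟ mid
  ... | yes x≡mid = ⊥-elim (Equivalence.to (s⇔ fzero) here x≡mid)
  ... | no _      = let off , cen = subset-sizes s p (λ m → tail-⇔ (s⇔ (fsuc m))) in cong suc off , cen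
  subset-sizes (false ∷ s) (x ∷ p) s⇔ with x ≟ mid
  ... | yes _      = let off , cen = subset-sizes s p (λ m → tail-⇔ (s⇔ (fsuc m))) in off , cong suc cen
  ... | no x≢mid   with Equivalence.from (s⇔ fzero) x≢mid
  ...   | ()

opposite-fixed⇔ : ∀ {n} (x : Fin n) → (opposite x ≡ x) ⇔ (suc (toℕ x + toℕ x) ≡ n)
opposite-fixed⇔ {n} x = mk⇔ to from
  where
    t = toℕ x
    to : opposite x ≡ x → suc (t + t) ≡ n
    to e = begin
        suc (t + t)            ≡⟨ sym (+-suc t t) ⟩
        t + suc t              ≡⟨ cong (_+ suc t) (trans (cong toℕ (sym e)) (opposite-prop x)) ⟩
        (n ∸ suc t) + suc t    ≡⟨ m∸n+n≡m (toℕ<n x) ⟩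
        n                      ∎
      where open ≡-Reasoning
    from : suc (t + t) ≡ n → opposite x ≡ x
    from e = toℕ-injective (begin
        toℕ (opposite x)       ≡⟨ opposite-prop x ⟩
        n ∸ suc t              ≡⟨ cong (_∸ suc t) (sym e) ⟩
        (t + t) ∸ t            ≡⟨ m+n∸n≡m t t ⟩
        t                      ∎)
      where open ≡-Reasoning

module OddSide {n : ℕ} (odd : n % 2 ≡ 1) (mid : Fin n) (mid-value : toℕ mid ≡ (n ∸ 1) / 2) where

  private
    h = n / 2

    n≡1+2h : n ≡ suc (h * 2)
    n≡1+2h = trans (m≡m%n+[m/n]*n n 2) (cong (_+ h * 2) odd)

    double : ∀ a → a * 2 ≡ a + a
    double a = solve 1 (λ a → a :* con 2 := a :+ a) refl a

    mid≡h : toℕ mid ≡ h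
    mid≡h = trans mid-value (trans (cong (λ m → (m ∸ 1) / 2) n≡1+2h) (m*n/n≡m h 2))

    mid-double : suc (toℕ mid + toℕ mid) ≡ n
    mid-double = trans (cong (λ t → suc (t + t)) mid≡h) (trans (cong suc (sym (double h))) (sym n≡1+2h))

  mid-fixed : opposite mid ≡ mid
  mid-fixed = Equivalence.from (opposite-fixed⇔ mid) mid-double

  fixed-unique : ∀ x → opposite x ≡ x → x ≡ mid
  fixed-unique x e = toℕ-injective (*-cancelʳ-≡ (toℕ x) (toℕ mid) 2
    (trans (double (toℕ x)) (trans (suc-injective (trans (Equivalence.to (opposite-fixed⇔ x) e) (sym mid-double)))
                                   (sym (double (toℕ mid))))))

module Axis {n : ℕ} (mid : Fin n) (mid-fixed : opposite mid ≡ mid)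
            (fixed-unique : ∀ x → opposite x ≡ x → x ≡ mid) (j₀ : Fin n) (j₀≢mid : ¬ j₀ ≡ mid) where

  open Centre mid mid-fixed

  OnAxis : Fin n → Set
  OnAxis x = x ≡ mid ⊎ x ≡ j₀ ⊎ x ≡ opposite j₀

  j₀≢j̄₀ : ¬ j₀ ≡ opposite j₀
  j₀≢j̄₀ e = j₀≢mid (fixed-unique j₀ (sym e))

  j̄₀≢mid : ¬ opposite j₀ ≡ mid
  j̄₀≢mid e = j₀≢mid (trans (sym (opposite-involutive j₀)) (trans (cong opposite e) mid-fixed))

  open Lines j₀ j₀≢j̄₀

  axis-coordinate : ∀ a → ev a mid ≡ mid → OnAxis (ev a j₀) × (Moving a ⇔ (¬ ev a j₀ ≡ mid))
  axis-coordinate inc     _ = inj₂ (inj₁ refl) , mk⇔ (λ _ → j₀≢mid) (λ _ → inc)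
  axis-coordinate dec     _ = inj₂ (inj₂ refl) , mk⇔ (λ _ → j̄₀≢mid) (λ _ → dec)
  axis-coordinate (cst a) e = inj₁ e , mk⇔ (λ ()) (λ a≢mid → ⊥-elim (a≢mid e))

  axis-point : ∀ {d} (u : Pattern n d) → (∀ m → ev (lookup u m) mid ≡ mid) → ∀ {p} → trace u j₀ ≡ p →
               (∀ m → OnAxis (lookup p m)) × (∀ m → Moving (lookup u m) ⇔ (¬ lookup p m ≡ mid))
  axis-point u pinned refl =
      (λ m → subst OnAxis (sym (lookup-trace u m j₀)) (proj₁ (axis-coordinate (lookup u m) (pinned m))))
    , (λ m → subst (λ x → Moving (lookup u m) ⇔ (¬ x ≡ mid)) (sym (lookup-trace u m j₀))
                   (proj₂ (axis-coordinate (lookup u m) (pinned m))))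

  -- At parameter j₀ a centred coordinate admits only the constant direction,
  -- an off-centre one also exactly one moving direction.
  length-dirsThrough-centred : length (dirsThrough j₀ mid) ≡ 1
  length-dirsThrough-centred = cong (λ t → suc (length t))
    (filter-none (λ o → ev o j₀ ≟ mid) {xs = movingDirs} (j₀≢mid ∷ j̄₀≢mid ∷ []))

  length-dirsThrough-off : ∀ {x} → OnAxis x → ¬ x ≡ mid → length (dirsThrough j₀ x) ≡ 2
  length-dirsThrough-off (inj₁ x≡mid)        x≢mid = ⊥-elim (x≢mid x≡mid)
  length-dirsThrough-off (inj₂ (inj₁ refl)) _ = cong (λ t → suc (length t))
    (trans (filter-accept (λ o → ev o j₀ ≟ j₀) {x = inc} {xs = dec ∷ []} refl)
           (cong (inc ∷_) (filter-reject (λ o → ev o j₀ ≟ j₀) {x = dec} {xs = []} (j₀≢j̄₀ ∘ sym))))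
  length-dirsThrough-off (inj₂ (inj₂ refl)) _ = cong (λ t → suc (length t))
    (trans (filter-reject (λ o → ev o j₀ ≟ opposite j₀) {x = inc} {xs = dec ∷ []} j₀≢j̄₀)
           (filter-accept (λ o → ev o j₀ ≟ opposite j₀) {x = dec} {xs = []} refl))

  length-patternsThrough-axis : ∀ {d} (p : Point n d) → (∀ m → OnAxis (lookup p m)) →
                                length (patternsThrough j₀ p) ≡ 2 ^ offCentre p
  length-patternsThrough-axis []      _    = refl
  length-patternsThrough-axis (x ∷ p) axis with x ≟ mid
  ... | yes x≡mid = trans (length-cartesianProductWith _∷_ (dirsThrough j₀ x) (patternsThrough j₀ p))
    (trans (cong₂ _*_ (trans (cong (λ y → length (dirsThrough j₀ y)) x≡mid) length-dirsThrough-centred)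
                      (length-patternsThrough-axis p (axis ∘ fsuc)))
           (*-identityˡ _))
  ... | no x≢mid  = trans (length-cartesianProductWith _∷_ (dirsThrough j₀ x) (patternsThrough j₀ p))
    (cong₂ _*_ (length-dirsThrough-off (axis fzero) x≢mid) (length-patternsThrough-axis p (axis ∘ fsuc)))

  parameter-on-axis : ∀ {d} (p : Point n d) → (∀ m → OnAxis (lookup p m)) →
                      ∀ v → NonConstant v → ∀ {j} → trace v j ≡ p → j ≡ mid ⊎ j ≡ j₀ ⊎ j ≡ opposite j₀
  parameter-on-axis p axis v nc {j} e with moving-coordinate v nc
  ... | m , mv with ev-solve mv (trans (sym (lookup-trace v m j)) (cong (λ x → lookup x m) e)) | axis m
  ...   | inj₁ j≡x | inj₁ x≡mid = inj₁ (trans j≡x x≡mid)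
  ...   | inj₂ j≡x̄ | inj₁ x≡mid = inj₁ (trans j≡x̄ (trans (cong opposite x≡mid) mid-fixed))
  ...   | inj₁ j≡x | inj₂ (inj₁ x≡j₀) = inj₂ (inj₁ (trans j≡x x≡j₀))
  ...   | inj₂ j≡x̄ | inj₂ (inj₁ x≡j₀) = inj₂ (inj₂ (trans j≡x̄ (cong opposite x≡j₀)))
  ...   | inj₁ j≡x | inj₂ (inj₂ x≡j̄₀) = inj₂ (inj₂ (trans j≡x x≡j̄₀))
  ...   | inj₂ j≡x̄ | inj₂ (inj₂ x≡j̄₀) =
    inj₂ (inj₁ (trans j≡x̄ (trans (cong opposite x≡j̄₀) (opposite-involutive j₀))))

  -- Representatives of the lines through an axis point p ≠ centre: the
  -- non-constant patterns passing p at parameter j₀ (list B), and the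
  -- canonical patterns passing p at parameter mid (list A).
  module Representatives {d} (p : Point n d) (axis : ∀ m → OnAxis (lookup p m)) where

    A B : List (Pattern n d)
    A = filter canonical? (patternsThrough mid p)
    B = filter nonConstant? (patternsThrough j₀ p)

    Listed : Pattern n d → Set
    Listed v = (trace v j₀ ≡ p × NonConstant v) ⊎ (trace v mid ≡ p × Canonical v)

    from-B : ∀ {v} → v ∈ B → trace v j₀ ≡ p × NonConstant v
    from-B {v} v∈B = let v∈S , nc = ∈-filter⁻ nonConstant? v∈B
                     in Equivalence.to (∈-patternsThrough j₀ p v) v∈S , nc

    from-A : ∀ {v} → v ∈ A → trace v mid ≡ p × Canonical v
    from-A {v} v∈A = let v∈S , c = ∈-filter⁻ canonical? v∈A
                     in Equivalence.to (∈-patternsThrough mid p v) v∈S , c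

    classify : ∀ {v} → v ∈ B ++ A → Listed v
    classify v∈ with ∈-++⁻ B v∈
    ... | inj₁ v∈B = inj₁ (from-B v∈B)
    ... | inj₂ v∈A = inj₂ (from-A v∈A)

    list-B : ∀ {v} → trace v j₀ ≡ p → NonConstant v → v ∈ B ++ A
    list-B {v} e nc = ∈-++⁺ˡ (∈-filter⁺ nonConstant? (Equivalence.from (∈-patternsThrough j₀ p v) e) nc)

    list-A : ∀ {v} → trace v mid ≡ p → Canonical v → v ∈ B ++ A
    list-A {v} e c = ∈-++⁺ʳ B (∈-filter⁺ canonical? (Equivalence.from (∈-patternsThrough mid p v) e) c)

    listed-nonConstant : ∀ {v} → Listed v → NonConstant v
    listed-nonConstant     (inj₁ (_ , nc)) = nc
    listed-nonConstant {v} (inj₂ (_ , c))  = canonical⇒nonConstant v c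

    listed-through : ∀ {v} → Listed v → p ∈ₗ trace v
    listed-through (inj₁ (e , _)) = j₀ , e
    listed-through (inj₂ (e , _)) = mid , e

    -- A pattern passes p at most once, and j₀ ≠ mid.
    unique : Unique (B ++ A)
    unique = Unique.++⁺ (Unique.filter⁺ nonConstant? (patternsThrough-unique j₀ p))
                        (Unique.filter⁺ canonical? (patternsThrough-unique mid p))
                        (λ (v∈B , v∈A) → let e , nc = from-B v∈B
                                         in j₀≢mid (trace-injective _ nc (trans e (sym (proj₁ (from-A v∈A))))))

    -- A listed pattern and its flip would pass p at two parameters related
    -- by 'opposite', which j₀ and mid never are; two canonical patterns are
    -- never flips of each other.
    flip-free : ∀ {v} → v ∈ B ++ A → ¬ flip v ∈ B ++ A
    flip-free {v} v∈ v̄∈ = excluded (classify v∈) (classify v̄∈)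
      where
        flipped : ∀ {j} → trace (flip v) j ≡ p → trace v (opposite j) ≡ p
        flipped {j} e = trans (sym (trace-flip v j)) e
        at-most-once : NonConstant v → ∀ {i j} → trace v i ≡ p → trace v j ≡ p → i ≡ j
        at-most-once nc e e′ = trace-injective v nc (trans e (sym e′))
        excluded : Listed v → Listed (flip v) → ⊥
        excluded (inj₁ (e , nc)) (inj₁ (e′ , _)) = j₀≢j̄₀ (at-most-once nc e (flipped e′))
        excluded (inj₁ (e , nc)) (inj₂ (e′ , _)) = j₀≢mid (trans (at-most-once nc e (flipped e′)) mid-fixed)
        excluded (inj₂ (e , c))  (inj₁ (e′ , _)) =
          j̄₀≢mid (sym (at-most-once (canonical⇒nonConstant v c) e (flipped e′)))
        excluded (inj₂ (_ , c))  (inj₂ (_ , c′)) = canonical-flip v c c′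

    -- Every line through p passes it at mid, j₀ or j̄₀; reversing the
    -- parameter if needed, it is represented in the list.
    complete : ∀ v → NonConstant v → p ∈ₗ trace v → v ∈ B ++ A ⊎ flip v ∈ B ++ A
    complete v nc (j , e) with parameter-on-axis p axis v nc e
    ... | inj₂ (inj₁ refl) = inj₁ (list-B e nc)
    ... | inj₂ (inj₂ refl) = inj₂ (list-B (trans (trace-flip v j₀) e) (flip-nonConstant v nc))
    ... | inj₁ refl with canonical-or-flip v nc
    ...   | inj₁ c = inj₁ (list-A e c)
    ...   | inj₂ c̄ = inj₂ (list-A (trans (trace-flip v mid) (trans (cong (trace v) mid-fixed) e)) c̄)

    number-of-lines : length (B ++ A) ≡ 2 ^ offCentre p ∸ 1 + (3 ^ centred p ∸ 1) / 2
    number-of-lines = trans (length-++ B) (cong₂ _+_ count-B count-A)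
      where
        count-B : length B ≡ 2 ^ offCentre p ∸ 1
        count-B = cong (_∸ 1) (trans (nonConstant-count j₀ p) (length-patternsThrough-axis p axis))
        count-A : length A ≡ (3 ^ centred p ∸ 1) / 2
        count-A = sym (trans (cong (λ t → (t ∸ 1) / 2) (sym (trans (canonical-count p) (length-patternsThrough-centre p))))
                             (trans (cong (_/ 2) (*-comm 2 (length A))) (m*n/n≡m (length A) 2)))

  degree-on-axis : ∀ {d} (p : Point n d) → (∀ m → OnAxis (lookup p m)) →
                   Degree p (2 ^ offCentre p ∸ 1 + (3 ^ centred p ∸ 1) / 2)
  degree-on-axis p axis = subst (Degree p) number-of-lines
    (degree-from-patterns p (B ++ A) (All.tabulate (listed-nonConstant ∘ classify))
                          (All.tabulate (listed-through ∘ classify)) unique flip-free complete)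
    where open Representatives p axis

lemma15 : (n d k : ℕ) → 3 ≤ n → n % 2 ≡ 1 → 1 ≤ d →
    (c : Point n d) → (∀ m → toℕ (lookup c m) ≡ (n ∸ 1) / 2) →
    (ℓ : Seq n d) → IsLine ℓ → c ∈ₗ ℓ → HasDim ℓ k →
    (p : Point n d) → p ∈ₗ ℓ → ¬ (p ≡ c) →
    Degree p (2 ^ k ∸ 1 + (3 ^ (d ∸ k) ∸ 1) / 2)
lemma15 n@(suc (suc (suc _))) d@(suc _) k (s≤s (s≤s (s≤s _))) odd (s≤s _) c c-value
        ℓ ℓ-line (jc , ℓjc≡c) (s , ∣s∣≡k , s⇔) p (j₀ , ℓj₀≡p) p≢c =
  subst₂ (λ a b → Degree p (2 ^ a ∸ 1 + (3 ^ b ∸ 1) / 2)) off≡k centred≡d∸k (degree-on-axis p on-axis)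
  where
    mid = lookup c fzero
    open OddSide odd mid (c-value fzero)
    open Centre mid mid-fixed
    open Lines {n} fzero (λ ())

    u-line = line-pattern ℓ ℓ-line
    u = proj₁ u-line
    ℓ≗u = proj₂ (proj₂ u-line)
    c-centred : ∀ m → lookup (trace u jc) m ≡ mid
    c-centred m = trans (cong (λ x → lookup x m) (trans (sym (ℓ≗u jc)) ℓjc≡c))
                        (toℕ-injective (trans (c-value m) (sym (c-value fzero))))
    u-centre = centre-pattern u (proj₁ (proj₂ u-line)) c-centred

    j₀≢mid : ¬ j₀ ≡ mid
    j₀≢mid j₀≡mid = p≢c (trans (sym ℓj₀≡p) (trans (cong ℓ (trans j₀≡mid (sym (proj₁ u-centre)))) ℓjc≡c))
    open Axis mid mid-fixed fixed-unique j₀ j₀≢mid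

    p-axis = axis-point u (proj₂ u-centre) (trans (sym (ℓ≗u j₀)) ℓj₀≡p)
    on-axis = proj₁ p-axis
    sizes = subset-sizes s p λ m →
      ⇔-trans (s⇔ m) (⇔-trans (⇔-sym (coordinate-moves⇔ u ℓ≗u m)) (proj₂ p-axis m))
    off≡k : offCentre p ≡ k
    off≡k = trans (sym (proj₁ sizes)) ∣s∣≡k
    centred≡d∸k : centred p ≡ d ∸ k
    centred≡d∸k = trans (sym (proj₂ sizes)) (trans (∣∁p∣≡n∸∣p∣ s) (cong (d ∸_) ∣s∣≡k))
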